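{- Let $S$ be a decision rule system. Then: (a) If $C\in\{EAR,AR\}$, then $h_C(S)\ge\beta(S)$. (b) If $C\in\{AD,SR\}$, then $h_{EC}(S)\ge\beta(I_C(S))$, where $EC$ denotes $EAD$ when $C=AD$ and $ESR$ when $C=SR$. (c) If $C\in\{AD,SR\}$ and $S$ is incomplete, then $h_C(S)\ge\beta(S)$.
   Context: Let $\omega=\{0,1,2,\dots\}$ and let $\{a_i:i\in\omega\}$ be a set of attributes. A decision rule $r$ is an expression $(a_{i_1}=\delta_1)\wedge\cdots\wedge(a_{i_m}=\delta_m)\to\sigma$ with $m\in\omega$, pairwise different attributes, and $\delta_j,\sigma\in\omega$. Its length is $m$, its right-hand side is $\sigma$, $A(r)=\{a_{i_1},\dots,a_{i_m}\}$, and $K(r)=\{a_{i_1}=\delta_1,\dots,a_{i_m}=\delta_m\}$. Two rules are equal iff they have the same $K(\cdot)$ and the same right-hand side. A decision rule system $S$ is a finite nonempty set of decision rules. Let $A(S)=\bigcup_{r\in S}A(r)$, $n(S)=|A(S)|$, and let $D(Z)$ be the set of right-hand sides of rules in $Z\subseteq S$. For $a_i\in A(S)$, $V_S(a_i)=\{\delta:(a_i=\delta)\in\bigcup_{r\in S}K(r)\}$ and $EV_S(a_i)=V_S(a_i)\cup\{*\}$, where $*$ is a symbol not in $\omega$. If $n(S)>0$ and $A(S)=\{a_{j_1},\dots,a_{j_n}\}$ with $j_1<\dots<j_n$, let $V(S)=V_S(a_{j_1})\times\cdots\times V_S(a_{j_n})$, and for $\bar\delta=(\delta_1,\dots,\delta_n)$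 let $K(S,\bar\delta)=\{a_{j_1}=\delta_1,\dots,a_{j_n}=\delta_n\}$. A set of equations $\{a_{i_1}=\delta_1,\dots,a_{i_m}=\delta_m\}$ with $\delta_j\in\omega\cup\{*\}$ is inconsistent if there are $l\ne t$ with $i_l=i_t$ and $\delta_l\ne\delta_t$, and consistent otherwise. $S$ is incomplete if there is $\bar\delta\in V(S)$ such that $K(r)\cup K(S,\bar\delta)$ is inconsistent for every $r\in S$. Otherwise $S$ is complete; if $n(S)=0$, $S$ is considered complete. A node cover of $S$ is a set $B\subseteq A(S)$ with $A(r)\cap B\ne\emptyset$ for every $r\in S$ with $A(r)\ne\emptyset$. $\beta(S)$ is the minimum cardinality of a node cover; it is $0$ if $A(S)=\emptyset$. $I_{SR}(S)=S$ if $S$ contains no rule of length $0$. Otherwise $I_{SR}(S)$ is the set of rules of $S$ of length $0$. Let $D_0(S)$ be the set of right-hand sides of length-$0$ rules of $S$. Then $I_{AD}(S)$ consists of all rules of $S$ of length $0$ together with all rules of $S$ whose right-hand side is not in $D_0(S)$. A decision tree over $S$ is a finite directed rooted tree with working nodes labeled by attributes from $A(S)$ and terminal nodes labeled by subsets of $S$. In an o-tree, a working node labeled $a_i$ has exactly $|V_S(a_i)|$ outgoing edges, labeled with pairwise distinct elements of $V_S(a_i)$. In an e-tree, it has exactly $|EV_S(a_i)|$ outgoing edges, labeled with pairwise distinct elements of $EV_S(a_i)$. For a complete path $\xi$ (root to terminal node), $K(\xi)$ is the set of equations $a_i=\delta$ with $a_i$ labeling a working node of $\xi$ and $\delta$ labeling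 the edge of $\xi$ leaving it. $\tau(\xi)$ is the label of the terminal node of $\xi$, and $h(\xi)$ is the number of working nodes of $\xi$. The depth $h(\Gamma)$ is the maximum of $h(\xi)$ over complete paths. An o-tree (resp. e-tree) solves $AR(S)$ (resp. $EAR(S)$) if every complete path $\xi$ with $K(\xi)$ consistent satisfies: $K(r)\subseteq K(\xi)$ for all $r\in\tau(\xi)$, and $K(r)\cup K(\xi)$ is inconsistent for all $r\in S\setminus\tau(\xi)$. It solves $AD(S)$ (resp. $EAD(S)$) if every such $\xi$ satisfies: $K(r)\subseteq K(\xi)$ for $r\in\tau(\xi)$, and $K(r)\cup K(\xi)$ is inconsistent for each $r\in S\setminus\tau(\xi)$ whose right-hand side is not in $D(\tau(\xi))$. It solves $SR(S)$ (resp. $ESR(S)$) if every such $\xi$ satisfies: $K(r)\subseteq K(\xi)$ for $r\in\tau(\xi)$, and if $\tau(\xi)=\emptyset$ then $K(r)\cup K(\xi)$ is inconsistent for all $r\in S$. For $C\in\{AR,EAR,AD,EAD,SR,ESR\}$, $h_C(S)$ is the minimum depth of a decision tree over $S$ solving $C(S)$. If $n(S)=0$, this is $0$. -}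

module Defs where

open import Data.Nat using (ℕ; zero; suc; _<_; _≤_; _⊔_)
open import Data.Bool using (Bool; true; false; _∨_; not) renaming (_≟_ to _≟ᵇ_)
open import Data.Maybe using (Maybe; just; nothing)
open import Data.Product using (Σ; ∃; ∃-syntax; _×_; _,_; proj₁; proj₂)
open import Data.Empty using (⊥)
open import Data.Unit using (⊤)
open import Data.List using (List; []; _∷_; map; concatMap; filter; length; _++_; null)
open import Data.Bool.ListAction using (any)
open import Data.List.Membership.Propositional using (_∈_; _∉_)
open import Data.List.Relation.Binary.Subset.Propositional using (_⊆_)
open import Data.List.Relation.Unary.All using (All)
open import Data.List.Relation.Unary.Unique.Propositional using (Unique)
open import Data.List.Relation.Unary.Linked using (Linked)
open import Relation.Binary.PropositionalEquality using (_≡_; _≢_)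
open import Data.Nat using (_≡ᵇ_)

-- A rule (a_{i1}=δ1) ∧ ... ∧ (a_{im}=δm) → σ is represented by the list
-- of pairs (i_j , δ_j) together with σ.  Well-formedness (see WFRule)
-- demands the attribute indices to be strictly increasing: this is a
-- canonical representative of the finite set K(r) (so attributes are
-- pairwise different) and makes rule equality = propositional equality.

Rule : Set
Rule = List (ℕ × ℕ) × ℕ

K : Rule → List (ℕ × ℕ)
K = proj₁

rhs : Rule → ℕ
rhs = proj₂

attrs : Rule → List ℕ
attrs r = map proj₁ (K r)

WFRule : Rule → Set
WFRule r = Linked (λ p q → proj₁ p < proj₁ q) (K r)

DRS : List Rule → Set
DRS S = (S ≢ []) × All WFRule S × Unique S

InA : List Rule → ℕ → Set
InA S a = ∃[ r ] (r ∈ S × a ∈ attrs r)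

InV : List Rule → ℕ → ℕ → Set
InV S a δ = ∃[ r ] (r ∈ S × (a , δ) ∈ K r)

-- Equations a_i = δ with δ ∈ ω ∪ {*}; '*' is represented by 'nothing'.

Eqn : Set
Eqn = ℕ × Maybe ℕ

Inconsistent : List Eqn → Set
Inconsistent E = ∃[ i ] ∃[ d ] ∃[ d' ] ((i , d) ∈ E × (i , d') ∈ E × d ≢ d')

Consistent : List Eqn → Set
Consistent E = Inconsistent E → ⊥

KE : Rule → List Eqn
KE r = map (λ p → proj₁ p , just (proj₂ p)) (K r)

-- Completeness.
-- A tuple δ̄ ∈ V(S) is represented by a function f with f a ∈ V_S(a) for
-- every a ∈ A(S); K(S, δ̄) = { a = f a : a ∈ A(S) }.

AS : List Rule → List ℕ
AS S = concatMap attrs S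

KS : List Rule → (ℕ → ℕ) → List Eqn
KS S f = map (λ a → a , just (f a)) (AS S)

Incomplete : List Rule → Set
Incomplete S = ∃[ f ] ((∀ a → InA S a → InV S a (f a))
                      × (∀ r → r ∈ S → Inconsistent (KE r ++ KS S f)))

NodeCover : List Rule → List ℕ → Set
NodeCover S B = All (InA S) B × Unique B
              × (∀ r → r ∈ S → attrs r ≢ [] → ∃[ a ] (a ∈ B × a ∈ attrs r))

IsBeta : List Rule → ℕ → Set
IsBeta S b = (∃[ B ] (NodeCover S B × length B ≡ b))
           × (∀ B → NodeCover S B → b ≤ length B)

isLen0 : Rule → Bool
isLen0 r = null (K r)

D0 : List Rule → List ℕ
D0 S = map rhs (filter (λ r → _≟ᵇ_ (isLen0 r) true) S)

memℕ : ℕ → List ℕ → Bool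
memℕ x xs = any (λ y → x ≡ᵇ y) xs

I-SR : List Rule → List Rule
I-SR S with any isLen0 S
... | true  = filter (λ r → _≟ᵇ_ (isLen0 r) true) S
... | false = S

I-AD : List Rule → List Rule
I-AD S = filter (λ r → _≟ᵇ_ (isLen0 r ∨ not (memℕ (rhs r) (D0 S))) true) S

-- Decision trees.  Working node: attribute index and list of outgoing
-- edges (label, subtree); label 'nothing' is '*'.  Terminal node: a list
-- of rules (a subset of S).

data Tree : Set where
  leaf : List Rule → Tree
  node : ℕ → List (Maybe ℕ × Tree) → Tree

data Kind : Set where
  oK eK : Kind

Allowed : Kind → List Rule → ℕ → Maybe ℕ → Set
Allowed k  S a (just δ) = InV S a δ
Allowed oK S a nothing  = ⊥
Allowed eK S a nothing  = ⊤

data TreeOver (k : Kind) (S : List Rule) : Tree → Set where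
  leaf : ∀ {τ} → τ ⊆ S → TreeOver k S (leaf τ)
  node : ∀ {a es} → InA S a
       → Unique (map proj₁ es)
       → All (λ e → Allowed k S a (proj₁ e)) es
       → (∀ v → Allowed k S a v → v ∈ map proj₁ es)
       → All (λ e → TreeOver k S (proj₂ e)) es
       → TreeOver k S (node a es)

-- Complete paths: Path Γ K(ξ) τ(ξ); h(ξ) = length K(ξ).
data Path : Tree → List Eqn → List Rule → Set where
  leaf : ∀ {τ} → Path (leaf τ) [] τ
  node : ∀ {a es v t E τ} → (v , t) ∈ es → Path t E τ
       → Path (node a es) ((a , v) ∷ E) τ

mutual
  depth : Tree → ℕ
  depth (leaf _)    = 0
  depth (node _ es) = suc (depths es)

  depths : List (Maybe ℕ × Tree) → ℕ
  depths []             = 0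
  depths ((_ , t) ∷ es) = depth t ⊔ depths es

data Problem : Set where
  AR AD SR : Problem

Cond : Problem → List Rule → List Eqn → List Rule → Set
Cond AR S E τ = (∀ r → r ∈ τ → KE r ⊆ E)
              × (∀ r → r ∈ S → r ∉ τ → Inconsistent (KE r ++ E))
Cond AD S E τ = (∀ r → r ∈ τ → KE r ⊆ E)
              × (∀ r → r ∈ S → r ∉ τ → rhs r ∉ map rhs τ → Inconsistent (KE r ++ E))
Cond SR S E τ = (∀ r → r ∈ τ → KE r ⊆ E)
              × (τ ≡ [] → ∀ r → r ∈ S → Inconsistent (KE r ++ E))

-- Γ (of kind k) solves P(S): k = oK gives AR/AD/SR, k = eK gives EAR/EAD/ESR
Solves : Kind → Problem → List Rule → Tree → Set
Solves k P S Γ = ∀ E τ → Path Γ E τ → Consistent E → Cond P S E τ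

IsMinDepth : Kind → Problem → List Rule → ℕ → Set
IsMinDepth k P S h = (∃[ Γ ] (TreeOver k S Γ × Solves k P S Γ × depth Γ ≡ h))
                   × (∀ Γ → TreeOver k S Γ → Solves k P S Γ → h ≤ depth Γ)

{-# OPTIONS --safe #-}
module Submission where

-- Fix an assignment of values (or *) to the attributes that every working node
-- of the tree can follow.  Following it from the root yields a complete path ξ
-- with consistent K(ξ) and h(ξ) ≤ depth.  For each problem the condition at the
-- end of ξ forces every nonempty rule of the relevant system either to be
-- contained in K(ξ) or to contradict it; in both cases it shares an attribute
-- with ξ, so the attributes of ξ form a node cover and β ≤ h(ξ).  For e-trees
-- the assignment is constantly *, so every rule reached has length 0: this is
-- why for AD and SR only the nonempty rules of I_AD(S), resp. I_SR(S), are
-- forced.  For an incomplete S the assignment is a witness of incompleteness,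
-- so no rule is reached at all; for AR on o-trees any values from V_S will do.

open import Defs
open import Data.Nat using (ℕ; _≤_; _<_; z≤n; s≤s; _≡ᵇ_)
open import Data.Nat.Properties using (_≟_; ≤-trans; <-trans; <-irrefl; m≤m⊔n; m≤n⊔m; ≡⇒≡ᵇ)
open import Data.Bool using (true; false; T; _∨_; not)
open import Data.Bool.Properties using (T-≡; T-not-≡)
open import Data.Bool.ListAction using (any)
open import Data.Maybe using (Maybe; just; nothing)
open import Data.Product using (_×_; _,_; proj₁; proj₂; ∃-syntax)
open import Data.Product.Properties using () renaming (≡-dec to ×-≡-dec)
open import Data.Sum using (_⊎_; inj₁; inj₂)
open import Data.Empty using (⊥-elim)
open import Data.Unit using (tt)
open import Function using (Equivalence)
open import Relation.Nullary using (¬_; Dec; yes; no)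
open import Relation.Binary.PropositionalEquality using (_≡_; _≢_; refl; sym; trans; cong; subst)
open import Data.List using (List; []; _∷_; map; filter; length; _++_; concatMap; deduplicate; null)
open import Data.List.Properties using (map-∘; length-map; length-filter; length-deduplicate)
  renaming (≡-dec to List-≡-dec)
open import Data.List.Membership.Propositional using (_∈_; _∉_; find; lose)
open import Data.List.Membership.Propositional.Properties
  using (∈-map⁺; ∈-map⁻; ∈-++⁻; ∈-filter⁺; ∈-filter⁻; ∈-concatMap⁺; ∈-concatMap⁻;
         ∈-deduplicate⁺)
open import Data.List.Membership.DecPropositional _≟_ using (_∈?_)
import Data.List.Membership.DecPropositional as DecMembership
open import Data.List.Relation.Binary.Subset.Propositional using (_⊆_)
open import Data.List.Relation.Unary.All as All using (All; []; _∷_)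
open import Data.List.Relation.Unary.All.Properties using (anti-mono; ++⁺; map⁺)
import Data.List.Relation.Unary.Any as Any
open import Data.List.Relation.Unary.Any using (here; there)
open import Data.List.Relation.Unary.Any.Properties using (any⁺)
open import Data.List.Relation.Unary.AllPairs using (AllPairs; _∷_)
open import Data.List.Relation.Unary.Linked.Properties using (Linked⇒AllPairs)
open import Data.List.Relation.Unary.Unique.DecPropositional.Properties _≟_
  using (deduplicate-!; filter⁺)

Follows : (ℕ → Maybe ℕ) → List Eqn → Set
Follows g = All (λ e → proj₂ e ≡ g (proj₁ e))

Follows⇒Consistent : ∀ {g E} → Follows g E → Consistent E
Follows⇒Consistent gE (i , d , d' , i=d , i=d' , d≢d') =
  d≢d' (trans (All.lookup gE i=d) (sym (All.lookup gE i=d')))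

Inconsistent-++⇒shared-attribute : ∀ {E F : List Eqn} → Consistent E → Consistent F →
  Inconsistent (E ++ F) → ∃[ i ] (i ∈ map proj₁ E × i ∈ map proj₁ F)
Inconsistent-++⇒shared-attribute {E} cE cF (i , d , d' , i=d , i=d' , d≢d')
  with ∈-++⁻ E i=d | ∈-++⁻ E i=d'
... | inj₁ x | inj₁ y = ⊥-elim (cE (i , d , d' , x , y , d≢d'))
... | inj₁ x | inj₂ y = i , ∈-map⁺ proj₁ x , ∈-map⁺ proj₁ y
... | inj₂ x | inj₁ y = i , ∈-map⁺ proj₁ y , ∈-map⁺ proj₁ x
... | inj₂ x | inj₂ y = ⊥-elim (cF (i , d , d' , x , y , d≢d'))

strictly-sorted⇒functional : ∀ {ps : List (ℕ × ℕ)} → AllPairs (λ p q → proj₁ p < proj₁ q) ps →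
  ∀ {i d d'} → (i , d) ∈ ps → (i , d') ∈ ps → d ≡ d'
strictly-sorted⇒functional (_ ∷ _)         (here refl) (here refl) = refl
strictly-sorted⇒functional (i<ps ∷ _)      (here refl) (there m)   = ⊥-elim (<-irrefl refl (All.lookup i<ps m))
strictly-sorted⇒functional (i<ps ∷ _)      (there m)   (here refl) = ⊥-elim (<-irrefl refl (All.lookup i<ps m))
strictly-sorted⇒functional (_ ∷ sorted)    (there m)   (there m')  = strictly-sorted⇒functional sorted m m'

KE-consistent : ∀ {r} → WFRule r → Consistent (KE r)
KE-consistent {r} wf (i , _ , _ , i=d , i=d' , d≢d')
  with ∈-map⁻ _ i=d | ∈-map⁻ _ i=d'
... | _ , p∈K , refl | _ , p'∈K , refl = d≢d' (cong just (strictly-sorted⇒functional sorted p∈K p'∈K))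
  where
  sorted : AllPairs (λ p q → proj₁ p < proj₁ q) (K r)
  sorted = Linked⇒AllPairs (λ {x y z} → <-trans {proj₁ x} {proj₁ y} {proj₁ z}) wf

attrs-KE : ∀ r → map proj₁ (KE r) ≡ attrs r
attrs-KE r = sym (map-∘ (K r))

length0⇒attrs≡[] : ∀ r → K r ≡ [] → attrs r ≡ []
length0⇒attrs≡[] _ = cong (map proj₁)

Hits : List ℕ → Rule → Set
Hits B r = ∃[ a ] (a ∈ B × a ∈ attrs r)

Covers : List Rule → List ℕ → Set
Covers S B = ∀ r → r ∈ S → attrs r ≢ [] → Hits B r

Inconsistent⇒Hits : ∀ r {E} → WFRule r → Consistent E →
  Inconsistent (KE r ++ E) → Hits (map proj₁ E) r
Inconsistent⇒Hits r wf cE r⊥E with Inconsistent-++⇒shared-attribute (KE-consistent {r} wf) cE r⊥E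
... | a , a∈r , a∈E = a , a∈E , subst (a ∈_) (attrs-KE r) a∈r

⊆⇒Hits : ∀ r {E} → attrs r ≢ [] → KE r ⊆ E → Hits (map proj₁ E) r
⊆⇒Hits ([] , _)          r≢[] _   = ⊥-elim (r≢[] refl)
⊆⇒Hits ((a , _) ∷ _ , _) _    r⊆E = a , ∈-map⁺ proj₁ (r⊆E (here refl)) , here refl

⊆-Follows-*⇒length0 : ∀ r {E} → KE r ⊆ E → Follows (λ _ → nothing) E → K r ≡ []
⊆-Follows-*⇒length0 ([] , _)    _   _  = refl
⊆-Follows-*⇒length0 (_ ∷ _ , _) r⊆E *E with All.lookup *E (r⊆E (here refl))
... | ()

_∈R?_ : (r : Rule) (τ : List Rule) → Dec (r ∈ τ)
_∈R?_ = DecMembership._∈?_ (×-≡-dec (List-≡-dec (×-≡-dec _≟_ _≟_)) _≟_)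

∈AS⇒InA : ∀ S {a} → a ∈ AS S → InA S a
∈AS⇒InA S a∈AS = find (∈-concatMap⁻ attrs a∈AS)

InA⇒∈AS : ∀ {S a} → InA S a → a ∈ AS S
InA⇒∈AS (_ , r∈S , a∈r) = ∈-concatMap⁺ attrs (lose r∈S a∈r)

β≤length : ∀ {S B b} → Covers S B → IsBeta S b → b ≤ length B
β≤length {S} {B} B-covers (_ , minimal) =
  ≤-trans (minimal C (C⊆A , filter⁺ (_∈? AS S) (deduplicate-! B) , C-covers))
          (≤-trans (length-filter (_∈? AS S) (deduplicate _≟_ B)) (length-deduplicate _≟_ B))
  where
  C : List ℕ
  C = filter (_∈? AS S) (deduplicate _≟_ B)

  C⊆A : All (InA S) C
  C⊆A = All.tabulate λ a∈C → ∈AS⇒InA S (proj₂ (∈-filter⁻ (_∈? AS S) {xs = deduplicate _≟_ B} a∈C))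

  C-covers : Covers S C
  C-covers r r∈S r≢[] with B-covers r r∈S r≢[]
  ... | a , a∈B , a∈r =
    a , ∈-filter⁺ (_∈? AS S) (∈-deduplicate⁺ _≟_ a∈B) (InA⇒∈AS (r , r∈S , a∈r)) , a∈r

Admissible : Kind → List Rule → (ℕ → Maybe ℕ) → Set
Admissible k S g = ∀ a → InA S a → Allowed k S a (g a)

mutual
  path-following : ∀ {k S} g → Admissible k S g → ∀ {Γ} → TreeOver k S Γ →
    ∃[ E ] ∃[ τ ] (Path Γ E τ × Follows g E × length E ≤ depth Γ)
  path-following g adm (leaf _) = [] , _ , leaf , [] , z≤n
  path-following g adm {node a es} (node a∈A _ _ complete subtrees)
    with ∈-map⁻ proj₁ (complete (g a) (adm a a∈A))
  ... | (_ , t) , edge , refl with path-following-edges g adm subtrees edge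
  ...   | E , τ , ξ , gE , E≤ = (a , g a) ∷ E , τ , node edge ξ , refl ∷ gE , s≤s E≤

  path-following-edges : ∀ {k S} g → Admissible k S g →
    ∀ {es} → All (λ e → TreeOver k S (proj₂ e)) es → ∀ {v t} → (v , t) ∈ es →
    ∃[ E ] ∃[ τ ] (Path t E τ × Follows g E × length E ≤ depths es)
  path-following-edges g adm {(_ , t) ∷ _} (Γ ∷ _) (here refl)
    with path-following g adm Γ
  ... | E , τ , ξ , gE , E≤ = E , τ , ξ , gE , ≤-trans E≤ (m≤m⊔n _ _)
  path-following-edges g adm {(_ , t) ∷ _} (_ ∷ Γs) (there edge)
    with path-following-edges g adm Γs edge
  ... | E , τ , ξ , gE , E≤ = E , τ , ξ , gE , ≤-trans E≤ (m≤n⊔m (depth t) _)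

Path⇒τ⊆S : ∀ {k S Γ E τ} → TreeOver k S Γ → Path Γ E τ → τ ⊆ S
Path⇒τ⊆S (leaf τ⊆S)          leaf          = τ⊆S
Path⇒τ⊆S (node _ _ _ _ subs) (node edge ξ) = Path⇒τ⊆S (All.lookup subs edge) ξ

β≤minDepth : ∀ {k P S S'} g → Admissible k S g →
  (∀ {E τ} → τ ⊆ S → Follows g E → Cond P S E τ → Covers S' (map proj₁ E)) →
  ∀ b h → IsBeta S' b → IsMinDepth k P S h → b ≤ h
β≤minDepth g adm covers b _ β ((Γ , Γ-over , solves , refl) , _)
  with path-following g adm Γ-over
... | E , τ , ξ , gE , E≤ =
  ≤-trans (β≤length (covers (Path⇒τ⊆S Γ-over ξ) gE (solves E τ ξ (Follows⇒Consistent gE))) β)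
          (subst (_≤ depth Γ) (sym (length-map proj₁ E)) E≤)

*-admissible : ∀ S → Admissible eK S (λ _ → nothing)
*-admissible S _ _ = tt

valueIn : List (ℕ × ℕ) → ℕ → ℕ
valueIn []             _ = 0
valueIn ((i , δ) ∷ ps) a with a ≟ i
... | yes _ = δ
... | no  _ = valueIn ps a

valueIn-∈ : ∀ ps {a} → a ∈ map proj₁ ps → (a , valueIn ps a) ∈ ps
valueIn-∈ ((i , δ) ∷ ps) {a} a∈ps with a ≟ i | a∈ps
... | yes refl | _          = here refl
... | no  a≢i  | here a≡i   = ⊥-elim (a≢i a≡i)
... | no  _    | there a∈ps' = there (valueIn-∈ ps a∈ps')

valueIn-admissible : ∀ S → Admissible oK S (λ a → just (valueIn (concatMap K S) a))
valueIn-admissible S a (r , r∈S , a∈r) with ∈-map⁻ proj₁ a∈r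
... | (_ , δ) , aδ∈r , refl =
  find (∈-concatMap⁻ K (valueIn-∈ (concatMap K S) (∈-map⁺ proj₁ (∈-concatMap⁺ K (lose r∈S aδ∈r)))))

isLen0⇒length0 : ∀ r → T (isLen0 r) → K r ≡ []
isLen0⇒length0 ([] , _) _ = refl

length0⇒isLen0 : ∀ r → K r ≡ [] → T (isLen0 r)
length0⇒isLen0 ([] , _) _ = tt

∈-D0⁺ : ∀ {S r} → r ∈ S → K r ≡ [] → rhs r ∈ D0 S
∈-D0⁺ {r = r} r∈S r≡[] =
  ∈-map⁺ rhs (∈-filter⁺ _ r∈S (Equivalence.to T-≡ (length0⇒isLen0 r r≡[])))

∈⇒memℕ : ∀ {x xs} → x ∈ xs → T (memℕ x xs)
∈⇒memℕ {x} x∈xs = any⁺ (x ≡ᵇ_) (Any.map (λ { refl → ≡⇒≡ᵇ x x refl }) x∈xs)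

∈-I-AD⁻ : ∀ S {r} → r ∈ I-AD S → r ∈ S × (K r ≡ [] ⊎ rhs r ∉ D0 S)
∈-I-AD⁻ S {r} r∈I with ∈-filter⁻ _ r∈I
... | r∈S , kept = r∈S , length0-or-new (K r) kept
  where
  length0-or-new : ∀ ps → (null ps ∨ not (memℕ (rhs r) (D0 S))) ≡ true → ps ≡ [] ⊎ rhs r ∉ D0 S
  length0-or-new []      _   = inj₁ refl
  length0-or-new (_ ∷ _) new = inj₂ λ rhs∈D0 →
    subst T (Equivalence.to T-not-≡ (Equivalence.from T-≡ new)) (∈⇒memℕ rhs∈D0)

∈-I-SR⁻ : ∀ S {r} → r ∈ I-SR S → r ∈ S × (∀ {r'} → r' ∈ S → K r' ≡ [] → K r ≡ [])
∈-I-SR⁻ S {r} r∈I with any isLen0 S in has-length0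
... | true  = let r∈S , r-length0 = ∈-filter⁻ _ r∈I in
  r∈S , λ _ _ → isLen0⇒length0 r (Equivalence.from T-≡ r-length0)
... | false = r∈I , λ {r'} r'∈S r'≡[] →
  ⊥-elim (subst T has-length0 (any⁺ isLen0 (lose r'∈S (length0⇒isLen0 r' r'≡[]))))

AR-covers : ∀ {S E τ} → All WFRule S → Consistent E → Cond AR S E τ → Covers S (map proj₁ E)
AR-covers {τ = τ} wfs cE (contained , contradicts) r r∈S r≢[] with r ∈R? τ
... | yes r∈τ = ⊆⇒Hits r r≢[] (contained r r∈τ)
... | no  r∉τ = Inconsistent⇒Hits r (All.lookup wfs r∈S) cE (contradicts r r∈S r∉τ)

EAD-covers : ∀ {S E τ} → All WFRule S → τ ⊆ S → Follows (λ _ → nothing) E →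
  Cond AD S E τ → Covers (I-AD S) (map proj₁ E)
EAD-covers {S} {τ = τ} wfs τ⊆S *E (contained , contradicts) r r∈I r≢[] with ∈-I-AD⁻ S r∈I
... | _   , inj₁ r≡[]   = ⊥-elim (r≢[] (length0⇒attrs≡[] r r≡[]))
... | r∈S , inj₂ rhs∉D0 =
  Inconsistent⇒Hits r (All.lookup wfs r∈S) (Follows⇒Consistent *E) (contradicts r r∈S r∉τ rhs∉τ)
  where
  τ-length0 : ∀ {r'} → r' ∈ τ → K r' ≡ []
  τ-length0 {r'} r'∈τ = ⊆-Follows-*⇒length0 r' (contained r' r'∈τ) *E

  r∉τ : r ∉ τ
  r∉τ r∈τ = r≢[] (length0⇒attrs≡[] r (τ-length0 r∈τ))

  rhs∉τ : rhs r ∉ map rhs τ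
  rhs∉τ rhs∈τ with ∈-map⁻ rhs rhs∈τ
  ... | r' , r'∈τ , rhs≡ = rhs∉D0 (subst (_∈ D0 S) (sym rhs≡) (∈-D0⁺ (τ⊆S r'∈τ) (τ-length0 r'∈τ)))

ESR-covers : ∀ {S E τ} → All WFRule S → τ ⊆ S → Follows (λ _ → nothing) E →
  Cond SR S E τ → Covers (I-SR S) (map proj₁ E)
ESR-covers {S} {τ = []} wfs _ *E (_ , contradicts) r r∈I _ with ∈-I-SR⁻ S r∈I
... | r∈S , _ =
  Inconsistent⇒Hits r (All.lookup wfs r∈S) (Follows⇒Consistent *E) (contradicts refl r r∈S)
ESR-covers {S} {τ = r' ∷ _} wfs τ⊆S *E (contained , _) r r∈I r≢[] with ∈-I-SR⁻ S r∈I
... | _ , only-length0 =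
  ⊥-elim (r≢[] (length0⇒attrs≡[] r (only-length0 (τ⊆S (here refl))
    (⊆-Follows-*⇒length0 r' (contained r' (here refl)) *E))))

module IncompletenessWitness {S f} (contradicted : ∀ r → r ∈ S → Inconsistent (KE r ++ KS S f)) where

  not-⊆ : ∀ {E r} → Follows (λ a → just (f a)) E → r ∈ S → ¬ KE r ⊆ E
  not-⊆ {r = r} fE r∈S r⊆E =
    Follows⇒Consistent (++⁺ (anti-mono r⊆E fE) (map⁺ (All.universal (λ _ → refl) (AS S))))
                       (contradicted r r∈S)

  τ≡[] : ∀ {E τ} → Follows (λ a → just (f a)) E → τ ⊆ S → (∀ r → r ∈ τ → KE r ⊆ E) → τ ≡ []
  τ≡[] {τ = []}    _  _   _         = refl
  τ≡[] {τ = r ∷ _} fE τ⊆S contained = ⊥-elim (not-⊆ fE (τ⊆S (here refl)) (contained r (here refl)))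

  AD-covers : ∀ {E τ} → All WFRule S → τ ⊆ S → Follows (λ a → just (f a)) E →
    Cond AD S E τ → Covers S (map proj₁ E)
  AD-covers wfs τ⊆S fE (contained , contradicts) r r∈S _ with τ≡[] fE τ⊆S contained
  ... | refl = Inconsistent⇒Hits r (All.lookup wfs r∈S) (Follows⇒Consistent fE) (contradicts r r∈S (λ ()) (λ ()))

  SR-covers : ∀ {E τ} → All WFRule S → τ ⊆ S → Follows (λ a → just (f a)) E →
    Cond SR S E τ → Covers S (map proj₁ E)
  SR-covers wfs τ⊆S fE (contained , contradicts) r r∈S _ =
    Inconsistent⇒Hits r (All.lookup wfs r∈S) (Follows⇒Consistent fE) (contradicts (τ≡[] fE τ⊆S contained) r r∈S)

lemma7 : (S : List Rule) → DRS S →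
    -- (a) C ∈ {EAR, AR}
    ((∀ b h → IsBeta S b → IsMinDepth eK AR S h → b ≤ h)
     × (∀ b h → IsBeta S b → IsMinDepth oK AR S h → b ≤ h))
    -- (b) h_EAD(S) ≥ β(I_AD(S)), h_ESR(S) ≥ β(I_SR(S))
    × ((∀ b h → IsBeta (I-AD S) b → IsMinDepth eK AD S h → b ≤ h)
       × (∀ b h → IsBeta (I-SR S) b → IsMinDepth eK SR S h → b ≤ h))
    -- (c) S incomplete, C ∈ {AD, SR}
    × (Incomplete S →
        (∀ b h → IsBeta S b → IsMinDepth oK AD S h → b ≤ h)
        × (∀ b h → IsBeta S b → IsMinDepth oK SR S h → b ≤ h))
lemma7 S (_ , wfs , _) =
  ( β≤minDepth {P = AR} _ (*-admissible S) (λ _ *E → AR-covers wfs (Follows⇒Consistent *E))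
  , β≤minDepth {P = AR} _ (valueIn-admissible S) (λ _ gE → AR-covers wfs (Follows⇒Consistent gE)) )
  , ( β≤minDepth {P = AD} _ (*-admissible S) (EAD-covers wfs)
    , β≤minDepth {P = SR} _ (*-admissible S) (ESR-covers wfs) )
  , λ { (f , f∈V , contradicted) → let open IncompletenessWitness contradicted in
        β≤minDepth {P = AD} (λ a → just (f a)) f∈V (AD-covers wfs)
      , β≤minDepth {P = SR} (λ a → just (f a)) f∈V (SR-covers wfs) }
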